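{- Let $G$ be a finite simple graph with vertices totally ordered as $v_1<v_2<\cdots<v_n$, and let $(E_1,\dots,E_n)$ be the ordered partition of $E(G)$ induced by this ordering. Then $$IF(G,t)=\prod_{i=1}^n(t-|E_i|).$$
   Context: The edge $v_iv_j$ with $i<j$ is labelled $(i,j)$, and $E_j=\{(i,j):(i,j)\in E(G)\}$ for $j=1,\dots,n$ (so $E_1=\emptyset$). A subtree of $G$ is increasing if the vertices along any path starting at its minimum vertex increase in the ordering. Let $f_k$ be the number of spanning forests of $G$ with $k$ edges all of whose components are increasing trees. The increasing spanning forest generating function is $IF(G,t)=\sum_{k=0}^{n-1}(-1)^k f_k t^{n-k}$. -}

module Defs where

open import Data.Nat as ℕ using (ℕ; zero; suc)
open import Data.Integer as ℤ using (ℤ; +_; -1ℤ)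
open import Data.Fin as Fin using (Fin)
open import Data.Fin.Subset using (Subset; _∈_; ∣_∣)
open import Data.List using (List; []; _∷_; length; filter; map; upTo; _∷ʳ_)
open import Data.List.Relation.Unary.Linked using (Linked)
open import Data.List.Relation.Unary.Unique.Propositional using (Unique)
open import Data.Product using (Σ; ∃; _×_; _,_; proj₁; proj₂)
open import Data.Sum using (_⊎_)
open import Relation.Binary.PropositionalEquality using (_≡_)
open import Relation.Nullary using (¬_)
open import Function.Definitions using (Injective)

-- Finite simple graphs on the ordered vertex set v₁ < ⋯ < vₙ,
-- represented by Fin n with its natural order.
-- The edge set is indexed by Fin m; edge e joins (i , j) with i < j
-- (label (i,j) of the paper); injectivity = no multiple edges;
-- i < j = no loops.

record Graph (n : ℕ) : Set where
  field
    m      : ℕ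
    edge   : Fin m → Fin n × Fin n
    lt     : ∀ e → proj₁ (edge e) Fin.< proj₂ (edge e)
    inj    : Injective _≡_ _≡_ edge

open Graph public

-- |E_j| : number of edges (i , j) whose larger endpoint is j
cardE : ∀ {n} (G : Graph n) → Fin n → ℕ
cardE G j = length (filter (λ e → proj₂ (edge G e) Fin.≟ j) (Data.List.allFin (m G)))
  where import Data.List

Adj : ∀ {n} (G : Graph n) → Subset (m G) → Fin n → Fin n → Set
Adj G S u v = ∃ λ e → e ∈ S × ((edge G e ≡ (u , v)) ⊎ (edge G e ≡ (v , u)))

IsPath : ∀ {n} (G : Graph n) → Subset (m G) → List (Fin n) → Set
IsPath G S xs = Unique xs × Linked (Adj G S) xs

IsCycle : ∀ {n} (G : Graph n) → Subset (m G) → Fin n → List (Fin n) → Set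
IsCycle G S x ys = 2 ℕ.≤ length ys × Unique (x ∷ ys) × Linked (Adj G S) ((x ∷ ys) ∷ʳ x)

Acyclic : ∀ {n} (G : Graph n) → Subset (m G) → Set
Acyclic G S = ∀ x ys → ¬ IsCycle G S x ys

Connected : ∀ {n} (G : Graph n) → Subset (m G) → Fin n → Fin n → Set
Connected G S u v = ∃ λ xs → (IsPath G S (u ∷ (xs ∷ʳ v)) ⊎ u ≡ v)

IsCompMin : ∀ {n} (G : Graph n) → Subset (m G) → Fin n → Set
IsCompMin G S r = ∀ w → Connected G S r w → r Fin.≤ w

AllCompsIncreasing : ∀ {n} (G : Graph n) → Subset (m G) → Set
AllCompsIncreasing G S =
  ∀ r xs → IsCompMin G S r → IsPath G S (r ∷ xs) → Linked Fin._<_ (r ∷ xs)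

IsIncForest : ∀ {n} (G : Graph n) → Subset (m G) → Set
IsIncForest G S = Acyclic G S × AllCompsIncreasing G S

-- c is the number of edge subsets S with |S| = k that form an increasing
-- spanning forest (explicit enumeration g : Fin c → Subset m, injective,
-- onto exactly those subsets)
IsIncForestCount : ∀ {n} (G : Graph n) → ℕ → ℕ → Set
IsIncForestCount G k c =
  Σ (Fin c → Subset (m G)) λ g →
    Injective _≡_ _≡_ g ×
    (∀ i → ∣ g i ∣ ≡ k × IsIncForest G (g i)) ×
    (∀ S → ∣ S ∣ ≡ k → IsIncForest G S → ∃ λ i → g i ≡ S)

-- Polynomials over ℤ as coefficient lists, lowest degree first.

Poly : Set
Poly = List ℤ

addP : Poly → Poly → Poly
addP [] q = q
addP (a ∷ p) [] = a ∷ p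
addP (a ∷ p) (b ∷ q) = (a ℤ.+ b) ∷ addP p q

mulLin : ℤ → Poly → Poly
mulLin a p = addP (+ 0 ∷ p) (map (λ c → ℤ.- a ℤ.* c) p)

prodLin : ∀ n → (Fin n → ℤ) → Poly
prodLin zero a = + 1 ∷ []
prodLin (suc n) a = mulLin (a Fin.zero) (prodLin n (λ i → a (Fin.suc i)))

-- IF(G,t) = Σ_{k=0}^{n-1} (-1)^k f_k t^{n-k}, coefficient list of length n+1:
-- coefficient of t^0 is 0, coefficient of t^j (1 ≤ j ≤ n) is (-1)^(n-j) f_(n-j)
IFcoeffs : ℕ → (ℕ → ℕ) → Poly
IFcoeffs n f = map coeff (upTo (suc n))
  where
  coeff : ℕ → ℤ
  coeff zero = + 0
  coeff (suc j) = (-1ℤ ℤ.^ (n ℕ.∸ suc j)) ℤ.* (+ f (n ℕ.∸ suc j))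

-- An edge set S is an increasing forest exactly when no two edges of S share their larger endpoint,
-- i.e. when every vertex has at most one smaller neighbour in S. If that holds, a walk without
-- backtracking can never go up and then down (the top vertex would have two smaller neighbours),
-- so there are no cycles and every path leaving the minimum of its component increases. Conversely,
-- two edges (a , j) and (b , j) of an increasing forest would give increasing paths from the minimum
-- of the component to a and to b, each extendable through j to the other one, forcing a ≤ b ≤ a.
-- Hence f_k is the number of ways to pick k distinct vertices and one edge of E_j below each chosen
-- vertex j, which is the elementary symmetric polynomial e_k(|E_1|, …, |E_n|); since |E_1| = 0,
-- Vieta's formula turns the sum Σ (-1)^k f_k t^(n-k) into ∏ (t - |E_i|).
module Submission where

open import Defs
open import Data.Nat using (ℕ; zero; suc; _+_; _*_; _∸_; _≤_; _<_; z≤n; s≤s)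
import Data.Nat.Properties as ℕₚ
open import Data.Nat.Solver using (module +-*-Solver)
open import Data.Integer as ℤ using (ℤ; +_; -1ℤ)
import Data.Integer.Properties as ℤₚ
import Data.Integer.Solver as ℤSolver
open import Data.Bool using (Bool; true; false; _∨_; if_then_else_)
import Data.Bool.Properties as Boolₚ
open import Data.Fin as Fin using (Fin)
import Data.Fin.Properties as Finₚ
open import Data.Fin.Induction using (<-wellFounded)
open import Data.Fin.Subset using (Subset; _∈_; ∣_∣; inside; outside; ⊥)
open import Data.Fin.Subset.Properties using (∉⊥; ∣⊥∣≡0)
open import Data.Vec using ([]; _∷_; here; there)
import Data.Vec.Properties as Vecₚ
open import Data.Vec.Functional using (head; tail)
open import Data.List as List
  using (List; []; _∷_; _++_; _∷ʳ_; [_]; length; map; filter; tabulate; applyUpTo)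
import Data.List.Properties as Listₚ
open import Data.List.Relation.Unary.Linked as Linked using (Linked; []; [-]; _∷_)
open import Data.List.Relation.Unary.All as All using (All; []; _∷_)
open import Data.List.Relation.Unary.All.Properties using (¬Any⇒All¬; tabulate⁺)
open import Data.List.Relation.Unary.AllPairs using ([]; _∷_)
open import Data.List.Relation.Unary.Any as Any using (here; there)
open import Data.List.Relation.Unary.Any.Properties using (lookup-index)
open import Data.List.Relation.Unary.Unique.Propositional using (Unique)
import Data.List.Relation.Unary.Unique.Propositional.Properties as Uniqueₚ
open import Data.List.Membership.Propositional using () renaming (_∈_ to _∈ₗ_; _∉_ to _∉ₗ_)
open import Data.List.Membership.Propositional.Properties
  using (∈-∃++; ∈-++⁻; ∈-++⁺ˡ; ∈-++⁺ʳ; ∈-map⁺; ∈-map⁻; ∈-lookup)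
import Data.List.Membership.DecPropositional as DecMembership
open import Data.Product using (∃; _×_; _,_; proj₁; proj₂)
open import Data.Sum as Sum using (_⊎_; inj₁; inj₂)
open import Data.Empty using (⊥-elim)
open import Data.Unit using (⊤; tt)
open import Function using (_∘_; id; _⇔_; mk⇔; Equivalence)
open import Function.Definitions using (Injective)
open import Induction.WellFounded using (Acc; acc)
open import Relation.Nullary using (¬_; yes; no; does)
open import Relation.Nullary.Decidable using (dec-true; dec-false; decidable-stable; ¬¬-excluded-middle)
open import Relation.Binary.Definitions using (DecidableEquality; tri<; tri≈; tri>)
open import Relation.Binary.PropositionalEquality
  using (_≡_; _≢_; _≗_; refl; sym; trans; cong; cong₂; subst; subst₂; ≢-sym; module ≡-Reasoning)

-- Walks as lists

module _ {A : Set} where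

  lastOf : A → List A → A
  lastOf a []      = a
  lastOf a (b ∷ l) = lastOf b l

  penultOf : A → List A → A
  penultOf a []          = a
  penultOf a (b ∷ [])    = a
  penultOf a (b ∷ c ∷ l) = penultOf b (c ∷ l)

  lastOf-∷ʳ : ∀ a l b → lastOf a (l ∷ʳ b) ≡ b
  lastOf-∷ʳ a []      b = refl
  lastOf-∷ʳ a (x ∷ l) b = lastOf-∷ʳ x l b

  penultOf-∷ʳ : ∀ a l b → penultOf a (l ∷ʳ b) ≡ lastOf a l
  penultOf-∷ʳ a []          b = refl
  penultOf-∷ʳ a (x ∷ [])    b = refl
  penultOf-∷ʳ a (x ∷ y ∷ l) b = penultOf-∷ʳ x (y ∷ l) b

  lastOf-∈ : ∀ a l → lastOf a l ∈ₗ a ∷ l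
  lastOf-∈ a []      = here refl
  lastOf-∈ a (b ∷ l) = there (lastOf-∈ b l)

  lastOf-++ : ∀ a l₁ l₂ → lastOf a (l₁ ++ l₂) ≡ lastOf (lastOf a l₁) l₂
  lastOf-++ a []       l₂ = refl
  lastOf-++ a (x ∷ l₁) l₂ = lastOf-++ x l₁ l₂

  lastOf-split : ∀ a l ys b zs → a ∷ l ≡ ys ++ b ∷ zs → lastOf a l ≡ lastOf b zs
  lastOf-split a l []       b zs refl = refl
  lastOf-split a l (y ∷ ys) b zs refl = lastOf-++ y ys (b ∷ zs)

  Unique-suffix : ∀ ys {zs} → Unique {A = A} (ys ++ zs) → Unique zs
  Unique-suffix []       u       = u
  Unique-suffix (y ∷ ys) (_ ∷ u) = Unique-suffix ys u

  Unique-∷ʳ : ∀ {l x} → Unique {A = A} l → x ∉ₗ l → Unique (l ∷ʳ x)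
  Unique-∷ʳ u x∉l = Uniqueₚ.++⁺ u ([] ∷ []) λ { (x∈l , here refl) → x∉l x∈l }

  module _ {R : A → A → Set} where

    Linked-last : ∀ {a b l} → Linked R (a ∷ b ∷ l) → R (penultOf a (b ∷ l)) (lastOf b l)
    Linked-last {l = []}    (r ∷ [-]) = r
    Linked-last {l = c ∷ l} (_ ∷ w)   = Linked-last w

    Linked-∷ʳ⁺ : ∀ a l {b} → Linked R (a ∷ l) → R (lastOf a l) b → Linked R (a ∷ (l ∷ʳ b))
    Linked-∷ʳ⁺ a []      _       r = r ∷ [-]
    Linked-∷ʳ⁺ a (c ∷ l) (s ∷ w) r = s ∷ Linked-∷ʳ⁺ c l w r

    Linked-∷ʳ⁻ : ∀ a l {b} → Linked R (a ∷ (l ∷ʳ b)) → R (lastOf a l) b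
    Linked-∷ʳ⁻ a []      (r ∷ _) = r
    Linked-∷ʳ⁻ a (c ∷ l) (_ ∷ w) = Linked-∷ʳ⁻ c l w

    Linked-++ : ∀ a l₁ {l₂} → Linked R (a ∷ l₁) → Linked R (lastOf a l₁ ∷ l₂) →
      Linked R (a ∷ (l₁ ++ l₂))
    Linked-++ a []       _       w′ = w′
    Linked-++ a (c ∷ l₁) (r ∷ w) w′ = r ∷ Linked-++ c l₁ w w′

    Linked-suffix : ∀ ys {zs} → Linked R (ys ++ zs) → Linked R zs
    Linked-suffix []       w = w
    Linked-suffix (y ∷ ys) w = Linked-suffix ys (Linked.tail w)

    Linked-head-last : (∀ {x y z} → R x y → R y z → R x z) →
      ∀ {a b l} → Linked R (a ∷ b ∷ l) → R a (lastOf b l)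
    Linked-head-last _       {l = []}    (r ∷ _) = r
    Linked-head-last R-trans {l = c ∷ l} (r ∷ w) = R-trans r (Linked-head-last R-trans w)

    Linked-reverse : (∀ {x y} → R x y → R y x) → ∀ a l {b} → Linked R (a ∷ l) → lastOf a l ≡ b →
      ∃ λ l′ → Linked R (b ∷ l′) × lastOf b l′ ≡ a
    Linked-reverse R-sym a []      _       refl = [] , [-] , refl
    Linked-reverse R-sym a (c ∷ l) (r ∷ w) end with Linked-reverse R-sym c l w end
    ... | l′ , w′ , end′ =
      l′ ∷ʳ a , Linked-∷ʳ⁺ _ l′ w′ (subst (λ z → R z a) (sym end′) (R-sym r)) , lastOf-∷ʳ _ l′ a

    loop-erase : DecidableEquality A → ∀ a l → Linked R (a ∷ l) →
      ∃ λ p → Unique (a ∷ p) × Linked R (a ∷ p) × lastOf a p ≡ lastOf a l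
    loop-erase _≟_ a []      _       = [] , [] ∷ [] , [-] , refl
    loop-erase _≟_ a (b ∷ l) (r ∷ w) with loop-erase _≟_ b l w
    ... | p , u , w′ , end with DecMembership._∈?_ _≟_ a (b ∷ p)
    ...   | no a∉  = b ∷ p , ¬Any⇒All¬ _ a∉ ∷ u , r ∷ w′ , end
    ...   | yes a∈ with ∈-∃++ a∈
    ...     | ys , zs , split =
      zs , Unique-suffix ys (subst Unique split u) , Linked-suffix ys (subst (Linked R) split w′) ,
      trans (sym (lastOf-split b p ys a zs split)) end

lastOf-maximum : ∀ {n} {a : Fin n} {l z} → Linked Fin._<_ (a ∷ l) → z ∈ₗ a ∷ l → z Fin.≤ lastOf a l
lastOf-maximum {l = []}    _ (here refl) = ℕₚ.≤-refl
lastOf-maximum {l = _ ∷ _} w (here refl) = ℕₚ.<⇒≤ (Linked-head-last Finₚ.<-trans w)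
lastOf-maximum {l = _ ∷ _} w (there z∈) = lastOf-maximum (Linked.tail w) z∈

NonBacktracking : ∀ {A : Set} → List A → Set
NonBacktracking (a ∷ b ∷ c ∷ l) = a ≢ c × NonBacktracking (b ∷ c ∷ l)
NonBacktracking _               = ⊤

Unique⇒NonBacktracking : ∀ {A : Set} (l : List A) → Unique l → NonBacktracking l
Unique⇒NonBacktracking []              _                  = tt
Unique⇒NonBacktracking (_ ∷ [])        _                  = tt
Unique⇒NonBacktracking (_ ∷ _ ∷ [])    _                  = tt
Unique⇒NonBacktracking (a ∷ b ∷ c ∷ l) ((_ ∷ a≢c ∷ _) ∷ u) =
  a≢c , Unique⇒NonBacktracking (b ∷ c ∷ l) u

NonBacktracking-∷ʳ : ∀ {A : Set} {x : A} l → Unique l → All (_≢ x) l → NonBacktracking (l ∷ʳ x)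
NonBacktracking-∷ʳ []              _                  _          = tt
NonBacktracking-∷ʳ (_ ∷ [])        _                  _          = tt
NonBacktracking-∷ʳ (_ ∷ _ ∷ [])    _                  (a≢x ∷ _)  = a≢x , tt
NonBacktracking-∷ʳ (a ∷ b ∷ c ∷ l) ((_ ∷ a≢c ∷ _) ∷ u) (_ ∷ ≢x) =
  a≢c , NonBacktracking-∷ʳ (b ∷ c ∷ l) u ≢x

cycle-nonBacktracking : ∀ {A : Set} (x y z : A) l →
  Unique (x ∷ y ∷ z ∷ l) → NonBacktracking (x ∷ y ∷ z ∷ l ∷ʳ x)
cycle-nonBacktracking x y z l (x≢@(_ ∷ x≢z ∷ _) ∷ u) =
  x≢z , NonBacktracking-∷ʳ (y ∷ z ∷ l) u (All.map ≢-sym x≢)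

¬¬-minimum : ∀ {n} (Q : Fin n → Set) {w} → Q w → ¬ ¬ (∃ λ r → Q r × ∀ v → Q v → r Fin.≤ v)
¬¬-minimum {n} Q {w} qw = descend w qw (<-wellFounded w)
  where
  descend : ∀ w → Q w → Acc Fin._<_ w → ¬ ¬ (∃ λ r → Q r × ∀ v → Q v → r Fin.≤ v)
  descend w qw (acc below) no-min = ¬¬-excluded-middle {A = ∃ λ v → Q v × v Fin.< w} λ where
    (yes (v , qv , v<w)) → descend v qv (below v<w) no-min
    (no no-smaller)      → no-min (w , qw , λ v qv → ℕₚ.≮⇒≥ λ v<w → no-smaller (v , qv , v<w))

InjectiveOn : ∀ {M n} → (Fin M → Fin n) → Subset M → Set
InjectiveOn col S = ∀ {e₁ e₂} → e₁ ∈ S → e₂ ∈ S → col e₁ ≡ col e₂ → e₁ ≡ e₂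

-- Increasing forests are the edge sets with distinct upper endpoints

upper : ∀ {n} (G : Graph n) → Fin (m G) → Fin n
upper G e = proj₂ (edge G e)

module _ {n} (G : Graph n) (S : Subset (m G)) where

  private
    _~_ : Fin n → Fin n → Set
    _~_ = Adj G S

  ~-sym : ∀ {u v} → u ~ v → v ~ u
  ~-sym (e , e∈S , inj₁ p) = e , e∈S , inj₂ p
  ~-sym (e , e∈S , inj₂ p) = e , e∈S , inj₁ p

  edge-< : ∀ {e u v} → edge G e ≡ (u , v) → u Fin.< v
  edge-< {e} p = subst (λ uv → proj₁ uv Fin.< proj₂ uv) p (lt G e)

  ~-irrefl : ∀ {u v} → u ~ v → u ≢ v
  ~-irrefl (_ , _ , inj₁ p) refl = Finₚ.<-irrefl refl (edge-< p)
  ~-irrefl (_ , _ , inj₂ p) refl = Finₚ.<-irrefl refl (edge-< p)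

  ~-upward : ∀ {u v} → u ~ v → u Fin.< v → ∃ λ e → e ∈ S × edge G e ≡ (u , v)
  ~-upward (e , e∈S , inj₁ p) _   = e , e∈S , p
  ~-upward (e , e∈S , inj₂ p) u<v = ⊥-elim (Finₚ.<-asym u<v (edge-< p))

  lowerNeighbour-unique : InjectiveOn (upper G) S →
    ∀ {a b c} → a ~ b → c ~ b → a Fin.< b → c Fin.< b → a ≡ c
  lowerNeighbour-unique injOn a~b c~b a<b c<b with ~-upward a~b a<b | ~-upward c~b c<b
  ... | e₁ , e₁∈S , p₁ | e₂ , e₂∈S , p₂ =
    cong proj₁ (trans (sym p₁) (trans (cong (edge G) same-edge) p₂))
    where
    same-edge = injOn e₁∈S e₂∈S (trans (cong proj₂ p₁) (sym (cong proj₂ p₂)))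

  module _ (injOn : InjectiveOn (upper G) S) where

    ascending : ∀ a b l → Linked _~_ (a ∷ b ∷ l) → NonBacktracking (a ∷ b ∷ l) →
      a Fin.< b → Linked Fin._<_ (a ∷ b ∷ l)
    ascending a b []      _            _        a<b = a<b ∷ [-]
    ascending a b (c ∷ l) (a~b ∷ b~c∷w) (a≢c , nb) a<b with Finₚ.<-cmp b c
    ... | tri< b<c _ _ = a<b ∷ ascending b c l b~c∷w nb b<c
    ... | tri≈ _ b≡c _ = ⊥-elim (~-irrefl (Linked.head b~c∷w) b≡c)
    ... | tri> _ _ c<b =
      ⊥-elim (a≢c (lowerNeighbour-unique injOn a~b (~-sym (Linked.head b~c∷w)) a<b c<b))

    valley : ∀ a b l → Linked _~_ (a ∷ b ∷ l) → NonBacktracking (a ∷ b ∷ l) → b Fin.< a →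
      lastOf b l Fin.< a ⊎ penultOf a (b ∷ l) Fin.< lastOf b l
    valley a b []      _       _        b<a = inj₁ b<a
    valley a b (c ∷ l) (_ ∷ w) (_ , nb) b<a with Finₚ.<-cmp b c
    ... | tri< b<c _ _ = inj₂ (Linked-last (ascending b c l w nb b<c))
    ... | tri≈ _ b≡c _ = ⊥-elim (~-irrefl (Linked.head w) b≡c)
    ... | tri> _ _ c<b = Sum.map₁ (λ last<b → Finₚ.<-trans last<b b<a) (valley b c l w nb c<b)

    injectiveOn⇒acyclic : Acyclic G S
    injectiveOn⇒acyclic x []       (() , _)
    injectiveOn⇒acyclic x (_ ∷ []) (s≤s () , _)
    injectiveOn⇒acyclic x (y₁ ∷ y₂ ∷ ys) (_ , u@(_ ∷ y₁∉ ∷ _) , w) with Finₚ.<-cmp x y₁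
    ... | tri< x<y₁ _ _ =
      Finₚ.<-irrefl (sym (lastOf-∷ʳ y₁ (y₂ ∷ ys) x))
        (Linked-head-last Finₚ.<-trans (ascending x y₁ _ w (cycle-nonBacktracking x y₁ y₂ ys u) x<y₁))
    ... | tri≈ _ x≡y₁ _ = ~-irrefl (Linked.head w) x≡y₁
    ... | tri> _ _ y₁<x with valley x y₁ _ w (cycle-nonBacktracking x y₁ y₂ ys u) y₁<x
    ...   | inj₁ last<x = Finₚ.<-irrefl (lastOf-∷ʳ y₁ (y₂ ∷ ys) x) last<x
    -- otherwise x is entered from below at both ends of the cycle, through y₁ and through yₖ
    ...   | inj₂ penult<last = All.lookup y₁∉ (lastOf-∈ y₂ ys) (sym yₖ≡y₁)
      where
      yₖ≡y₁ : lastOf y₂ ys ≡ y₁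
      yₖ≡y₁ = lowerNeighbour-unique injOn
        (subst₂ _~_ (penultOf-∷ʳ x (y₁ ∷ y₂ ∷ ys) x) (lastOf-∷ʳ y₁ (y₂ ∷ ys) x) (Linked-last w))
        (~-sym (Linked.head w))
        (subst₂ Fin._<_ (penultOf-∷ʳ x (y₁ ∷ y₂ ∷ ys) x) (lastOf-∷ʳ y₁ (y₂ ∷ ys) x) penult<last)
        y₁<x

    injectiveOn⇒allCompsIncreasing : AllCompsIncreasing G S
    injectiveOn⇒allCompsIncreasing r []       _     _                 = [-]
    injectiveOn⇒allCompsIncreasing r (x ∷ xs) r-min (u@(r≢ ∷ _) , w) =
      ascending r x xs w (Unique⇒NonBacktracking _ u) (Finₚ.≤∧≢⇒< (r-min x r~x) (All.head r≢))
      where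
      r~x : Connected G S r x
      r~x = [] , inj₁ ((All.head r≢ ∷ []) ∷ [] ∷ [] , Linked.head w ∷ [-])

  walkMinimum⇒compMin : ∀ r l → Linked _~_ (r ∷ l) →
    (∀ v l′ → Linked _~_ (v ∷ l′) → lastOf v l′ ≡ lastOf r l → r Fin.≤ v) → IsCompMin G S r
  walkMinimum⇒compMin r l _   _     v (_  , inj₂ r≡v)      = Finₚ.≤-reflexive r≡v
  walkMinimum⇒compMin r l r⋯ r-min v (xs , inj₁ (_ , r⋯v))
    with Linked-reverse ~-sym r (xs ∷ʳ v) r⋯v (lastOf-∷ʳ r xs v)
  ... | back , v⋯r , back-end =
    r-min v (back ++ l)
      (Linked-++ v back v⋯r (subst (λ z → Linked _~_ (z ∷ l)) (sym back-end) r⋯))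
      (trans (lastOf-++ v back l) (cong (λ z → lastOf z l) back-end))

  module _ (incr : AllCompsIncreasing G S) where

    -- if y were off the path, the path extended by j and y would leave r and end with a descent
    lowerNeighbour-≤ : ∀ {r p x y j} → IsCompMin G S r → IsPath G S (r ∷ p) → lastOf r p ≡ x →
      x ~ j → y ~ j → x Fin.< j → y Fin.< j → y Fin.≤ x
    lowerNeighbour-≤ {r} {p} {y = y} {j} r-min (u , w) refl x~j y~j x<j y<j
      with DecMembership._∈?_ Finₚ._≟_ y (r ∷ p)
    ... | yes y∈ = lastOf-maximum (incr r p r-min (u , w)) y∈
    ... | no y∉  = ⊥-elim (Finₚ.<-asym y<j j<y)
      where
      j∉ : j ∉ₗ r ∷ p
      j∉ j∈ = ℕₚ.<⇒≱ x<j (lastOf-maximum (incr r p r-min (u , w)) j∈)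
      y∉′ : y ∉ₗ (r ∷ p) ∷ʳ j
      y∉′ y∈ with ∈-++⁻ (r ∷ p) y∈
      ... | inj₁ y∈p        = y∉ y∈p
      ... | inj₂ (here y≡j) = Finₚ.<-irrefl y≡j y<j
      detour : IsPath G S (r ∷ ((p ∷ʳ j) ∷ʳ y))
      detour = Unique-∷ʳ (Unique-∷ʳ u j∉) y∉′ ,
        Linked-∷ʳ⁺ r (p ∷ʳ j) (Linked-∷ʳ⁺ r p w x~j) (subst (_~ y) (sym (lastOf-∷ʳ r p j)) (~-sym y~j))
      j<y : j Fin.< y
      j<y = subst (Fin._< y) (lastOf-∷ʳ r p j) (Linked-∷ʳ⁻ r (p ∷ʳ j) (incr r _ r-min detour))

    increasing⇒lowerNeighbour-unique : ∀ {a b j} → a ~ j → b ~ j → a Fin.< j → b Fin.< j → a ≡ b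
    increasing⇒lowerNeighbour-unique {a} {b} {j} a~j b~j a<j b<j =
      decidable-stable (a Fin.≟ b) λ a≢b → ¬¬-minimum WalkTo-a ([] , [-] , refl) (a≢b ∘ squeeze)
      where
      WalkTo-a : Fin n → Set
      WalkTo-a v = ∃ λ l → Linked _~_ (v ∷ l) × lastOf v l ≡ a

      squeeze : (∃ λ r → WalkTo-a r × ∀ v → WalkTo-a v → r Fin.≤ v) → a ≡ b
      squeeze (r , (l , r⋯a , end) , r-min) = Finₚ.≤-antisym a≤b b≤a
        where
        r-compMin : IsCompMin G S r
        r-compMin = walkMinimum⇒compMin r l r⋯a λ v l′ w e → r-min v (l′ , w , trans e end)
        r⋯b : Linked _~_ (r ∷ ((l ∷ʳ j) ∷ʳ b))
        r⋯b = Linked-∷ʳ⁺ r (l ∷ʳ j) (Linked-∷ʳ⁺ r l r⋯a (subst (_~ j) (sym end) a~j))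
                (subst (_~ b) (sym (lastOf-∷ʳ r l j)) (~-sym b~j))
        b≤a : b Fin.≤ a
        b≤a with loop-erase Finₚ._≟_ r l r⋯a
        ... | _ , u , w , end′ = lowerNeighbour-≤ r-compMin (u , w) (trans end′ end) a~j b~j a<j b<j
        a≤b : a Fin.≤ b
        a≤b with loop-erase Finₚ._≟_ r _ r⋯b
        ... | _ , u , w , end′ =
          lowerNeighbour-≤ r-compMin (u , w) (trans end′ (lastOf-∷ʳ r (l ∷ʳ j) b)) b~j a~j b<j a<j

    allCompsIncreasing⇒injectiveOn : InjectiveOn (upper G) S
    allCompsIncreasing⇒injectiveOn {e₁} {e₂} e₁∈S e₂∈S same =
      inj G (cong₂ _,_ (increasing⇒lowerNeighbour-unique a~j b~j (lt G e₁) b<j) same)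
      where
      b = proj₁ (edge G e₂)
      a~j = e₁ , e₁∈S , inj₁ refl
      b~j = e₂ , e₂∈S , inj₁ (cong (b ,_) (sym same))
      b<j = subst (b Fin.<_) (sym same) (lt G e₂)

isIncForest⇔injectiveOn : ∀ {n} (G : Graph n) S → IsIncForest G S ⇔ InjectiveOn (upper G) S
isIncForest⇔injectiveOn G S = mk⇔
  (λ (_ , incr) → allCompsIncreasing⇒injectiveOn G S incr)
  (λ (injOn : InjectiveOn (upper G) S) →
    injectiveOn⇒acyclic G S injOn , injectiveOn⇒allCompsIncreasing G S injOn)

-- Elementary symmetric polynomials

esym : ∀ {n} → (Fin n → ℕ) → ℕ → ℕ
esym         v zero    = 1
esym {zero}  v (suc k) = 0
esym {suc n} v (suc k) = esym (tail v) (suc k) + head v * esym (tail v) k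

esym-cong : ∀ {n} {v w : Fin n → ℕ} → v ≗ w → ∀ k → esym v k ≡ esym w k
esym-cong         v≗w zero    = refl
esym-cong {zero}  v≗w (suc k) = refl
esym-cong {suc n} v≗w (suc k) =
  cong₂ _+_ (esym-cong (v≗w ∘ Fin.suc) (suc k))
    (cong₂ _*_ (v≗w Fin.zero) (esym-cong (v≗w ∘ Fin.suc) k))

esym-zeros : ∀ {n} (v : Fin n → ℕ) → (∀ i → v i ≡ 0) → ∀ k → esym v (suc k) ≡ 0
esym-zeros {zero}  v v≡0 k = refl
esym-zeros {suc n} v v≡0 k rewrite v≡0 Fin.zero =
  trans (ℕₚ.+-identityʳ _) (esym-zeros (tail v) (v≡0 ∘ Fin.suc) k)

esym-beyond : ∀ {n} (v : Fin n → ℕ) k → n < k → esym v k ≡ 0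
esym-beyond {zero}  v (suc k) _         = refl
esym-beyond {suc n} v (suc k) (s≤s n<k) =
  cong₂ _+_ (esym-beyond (tail v) (suc k) (ℕₚ.m≤n⇒m≤1+n n<k))
    (trans (cong (head v *_) (esym-beyond (tail v) k n<k)) (ℕₚ.*-zeroʳ (head v)))

esym-head≡0 : ∀ {n} (v : Fin (suc n) → ℕ) → head v ≡ 0 → ∀ k → esym v k ≡ esym (tail v) k
esym-head≡0 v v₀≡0 zero    = refl
esym-head≡0 v v₀≡0 (suc k) rewrite v₀≡0 = ℕₚ.+-identityʳ _

-- e_(k+1) is affine in each variable, with slope e_k of the others
esym-increment : ∀ {n} (v w z : Fin n → ℕ) c →
  w c ≡ suc (v c) → (∀ i → i ≢ c → w i ≡ v i) → z c ≡ 0 → (∀ i → i ≢ c → z i ≡ v i) →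
  ∀ k → esym w (suc k) ≡ esym v (suc k) + esym z k
esym-increment {suc n} v w z Fin.zero w₀ wᵢ z₀ zᵢ k = begin
    esym (tail w) (suc k) + head w * esym (tail w) k
  ≡⟨ cong₂ (λ x y → x + head w * y) (esym-cong tail-w≗v (suc k)) (esym-cong tail-w≗v k) ⟩
    esym (tail v) (suc k) + head w * esym (tail v) k
  ≡⟨ cong (λ x → esym (tail v) (suc k) + x * esym (tail v) k) w₀ ⟩
    esym (tail v) (suc k) + suc (head v) * esym (tail v) k
  ≡⟨ solve 3 (λ a x b → a :+ (con 1 :+ x) :* b := (a :+ x :* b) :+ b) refl
       (esym (tail v) (suc k)) (head v) (esym (tail v) k) ⟩
    esym v (suc k) + esym (tail v) k
  ≡⟨ cong (λ x → esym v (suc k) + x) (sym (trans (esym-head≡0 z z₀ k) (esym-cong tail-z≗v k))) ⟩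
    esym v (suc k) + esym z k
  ∎
  where
  open ≡-Reasoning
  open +-*-Solver
  tail-w≗v : tail w ≗ tail v
  tail-w≗v i = wᵢ (Fin.suc i) λ ()
  tail-z≗v : tail z ≗ tail v
  tail-z≗v i = zᵢ (Fin.suc i) λ ()
esym-increment {suc n} v w z (Fin.suc c) w₀ wᵢ z₀ zᵢ k = step k
  where
  open +-*-Solver
  head-w : head w ≡ head v
  head-w = wᵢ Fin.zero λ ()
  head-z : head z ≡ head v
  head-z = zᵢ Fin.zero λ ()
  tail-step : ∀ k → esym (tail w) (suc k) ≡ esym (tail v) (suc k) + esym (tail z) k
  tail-step = esym-increment (tail v) (tail w) (tail z) c w₀
    (λ i i≢c → wᵢ (Fin.suc i) (i≢c ∘ Finₚ.suc-injective)) z₀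
    (λ i i≢c → zᵢ (Fin.suc i) (i≢c ∘ Finₚ.suc-injective))
  step : ∀ k → esym w (suc k) ≡ esym v (suc k) + esym z k
  step zero rewrite head-w | tail-step zero =
    solve 2 (λ a x → a :+ con 1 :+ x :* con 1 := a :+ x :* con 1 :+ con 1) refl
      (esym (tail v) 1) (head v)
  step (suc k) rewrite head-w | head-z | tail-step (suc k) | tail-step k =
    solve 5 (λ a b x c d → a :+ b :+ x :* (c :+ d) := a :+ x :* c :+ (b :+ x :* d)) refl
      (esym (tail v) (suc (suc k))) (esym (tail z) (suc k)) (head v)
      (esym (tail v) (suc k)) (esym (tail z) k)

-- Counting edge sets with distinct upper endpoints

∣p∣≡0⇒p≡⊥ : ∀ {M} (p : Subset M) → ∣ p ∣ ≡ 0 → p ≡ ⊥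
∣p∣≡0⇒p≡⊥ []            _     = refl
∣p∣≡0⇒p≡⊥ (outside ∷ p) ∣p∣≡0 = cong (outside ∷_) (∣p∣≡0⇒p≡⊥ p ∣p∣≡0)

if-else-cong : ∀ {A : Set} b {x y z : A} → (b ≡ false → y ≡ z) →
  (if b then x else y) ≡ (if b then x else z)
if-else-cong true  _   = refl
if-else-cong false y≡z = y≡z refl

module _ {n : ℕ} where

  count : ∀ {M} → (Fin M → Fin n) → Fin n → ℕ
  count {zero}  col j = 0
  count {suc M} col j = (if does (head col Fin.≟ j) then 1 else 0) + count (tail col) j

  count-head-other : ∀ {M} (col : Fin (suc M) → Fin n) {j} → head col ≢ j →
    count col j ≡ count (tail col) j
  count-head-other col {j} c≢j =
    cong (λ d → (if d then 1 else 0) + count (tail col) j) (dec-false (head col Fin.≟ j) c≢j)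

  count-head : ∀ {M} (col : Fin (suc M) → Fin n) →
    count col (head col) ≡ suc (count (tail col) (head col))
  count-head col =
    cong (λ d → (if d then 1 else 0) + count (tail col) (head col)) (dec-true (head col Fin.≟ head col) refl)

  -- col colours each edge by its upper endpoint; U marks the colours already used, which lets the
  -- count proceed one edge at a time.
  Admissible : ∀ {M} → (Fin M → Fin n) → (Fin n → Bool) → Subset M → Set
  Admissible col U S = InjectiveOn col S × (∀ {e} → e ∈ S → U (col e) ≡ false)

  available : ∀ {M} → (Fin M → Fin n) → (Fin n → Bool) → Fin n → ℕ
  available col U j = if U j then 0 else count col j

  occupy : (Fin n → Bool) → Fin n → Fin n → Bool
  occupy U c j = U j ∨ does (j Fin.≟ c)

  occupy-self : ∀ U c → occupy U c c ≡ true
  occupy-self U c = trans (cong (U c ∨_) (dec-true (c Fin.≟ c) refl)) (Boolₚ.∨-zeroʳ (U c))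

  occupy-other : ∀ U {c j} → j ≢ c → occupy U c j ≡ U j
  occupy-other U {c} {j} j≢c = trans (cong (U j ∨_) (dec-false (j Fin.≟ c) j≢c)) (Boolₚ.∨-identityʳ (U j))

  admissibleSubsets : ∀ {M} → (Fin M → Fin n) → (Fin n → Bool) → ℕ → List (Subset M)
  admissibleSubsets         col U zero    = [ ⊥ ]
  admissibleSubsets {zero}  col U (suc k) = []
  admissibleSubsets {suc M} col U (suc k) =
    map (outside ∷_) (admissibleSubsets (tail col) U (suc k)) ++
    (if U (head col) then [] else map (inside ∷_) (admissibleSubsets (tail col) (occupy U (head col)) k))

  module _ {M} (col : Fin (suc M) → Fin n) (U : Fin n → Bool) {S : Subset M} where

    admissible-outside⁻ : Admissible col U (outside ∷ S) → Admissible (tail col) U S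
    admissible-outside⁻ (injOn , free) =
      (λ e₁∈ e₂∈ same → Finₚ.suc-injective (injOn (there e₁∈) (there e₂∈) same)) , free ∘ there

    admissible-outside⁺ : Admissible (tail col) U S → Admissible col U (outside ∷ S)
    admissible-outside⁺ (injOn , free) =
      (λ { (there e₁∈) (there e₂∈) same → cong Fin.suc (injOn e₁∈ e₂∈ same) }) , λ { (there e∈) → free e∈ }

    admissible-inside⁻ : Admissible col U (inside ∷ S) →
      U (head col) ≡ false × Admissible (tail col) (occupy U (head col)) S
    admissible-inside⁻ (injOn , free) =
      free here , (λ e₁∈ e₂∈ same → Finₚ.suc-injective (injOn (there e₁∈) (there e₂∈) same)) , free′
      where
      free′ : ∀ {e} → e ∈ S → occupy U (head col) (tail col e) ≡ false
      free′ {e} e∈ with tail col e Fin.≟ head col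
      ... | yes same with () ← injOn (there e∈) here same
      ... | no _ = trans (Boolₚ.∨-identityʳ _) (free (there e∈))

    admissible-inside⁺ : U (head col) ≡ false → Admissible (tail col) (occupy U (head col)) S →
      Admissible col U (inside ∷ S)
    admissible-inside⁺ free₀ (injOn , free) = injOn′ , free′
      where
      other : ∀ {e} → e ∈ S → tail col e ≢ head col
      other e∈ same
        with () ← trans (sym (occupy-self U (head col)))
                        (subst (λ j → occupy U (head col) j ≡ false) same (free e∈))
      injOn′ : InjectiveOn col (inside ∷ S)
      injOn′ {Fin.zero}  {Fin.zero}  _          _          _    = refl
      injOn′ {Fin.zero}  {Fin.suc _} _          (there e∈) same = ⊥-elim (other e∈ (sym same))
      injOn′ {Fin.suc _} {Fin.zero}  (there e∈) _          same = ⊥-elim (other e∈ same)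
      injOn′ {Fin.suc _} {Fin.suc _} (there e₁∈) (there e₂∈) same = cong Fin.suc (injOn e₁∈ e₂∈ same)
      free′ : ∀ {e} → e ∈ inside ∷ S → U (col e) ≡ false
      free′ here       = free₀
      free′ (there e∈) = trans (sym (occupy-other U (other e∈))) (free e∈)

  admissibleSubsets-complete : ∀ {M} (col : Fin M → Fin n) U k S →
    ∣ S ∣ ≡ k → Admissible col U S → S ∈ₗ admissibleSubsets col U k
  admissibleSubsets-complete         col U zero    S             ∣S∣≡0 _   = here (∣p∣≡0⇒p≡⊥ S ∣S∣≡0)
  admissibleSubsets-complete {zero}  col U (suc k) []            ()    _
  admissibleSubsets-complete {suc M} col U (suc k) (outside ∷ S) ∣S∣≡k adm =
    ∈-++⁺ˡ (∈-map⁺ _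
      (admissibleSubsets-complete (tail col) U (suc k) S ∣S∣≡k (admissible-outside⁻ col U adm)))
  admissibleSubsets-complete {suc M} col U (suc k) (inside ∷ S)  ∣S∣≡k adm
    with U (head col) | admissible-inside⁻ col U adm
  ... | true  | () , _
  ... | false | _  , adm′ =
    ∈-++⁺ʳ _ (∈-map⁺ _
      (admissibleSubsets-complete (tail col) (occupy U (head col)) k S (ℕₚ.suc-injective ∣S∣≡k) adm′))

  admissibleSubsets-sound : ∀ {M} (col : Fin M → Fin n) U k S →
    S ∈ₗ admissibleSubsets col U k → ∣ S ∣ ≡ k × Admissible col U S
  admissibleSubsets-sound {M}     col U zero    S (here refl) =
    ∣⊥∣≡0 M , (λ e∈ → ⊥-elim (∉⊥ e∈)) , λ e∈ → ⊥-elim (∉⊥ e∈)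
  admissibleSubsets-sound {zero}  col U (suc k) S ()
  admissibleSubsets-sound {suc M} col U (suc k) S S∈
    with U (head col) in free₀ | ∈-++⁻ (map (outside ∷_) (admissibleSubsets (tail col) U (suc k))) S∈
  ... | _     | inj₁ S∈₁ with ∈-map⁻ _ S∈₁
  ...   | S′ , S′∈ , refl with admissibleSubsets-sound (tail col) U (suc k) S′ S′∈
  ...     | ∣S′∣≡k , adm = ∣S′∣≡k , admissible-outside⁺ col U adm
  admissibleSubsets-sound {suc M} col U (suc k) S S∈ | false | inj₂ S∈₂ with ∈-map⁻ _ S∈₂
  ...   | S′ , S′∈ , refl with admissibleSubsets-sound (tail col) (occupy U (head col)) k S′ S′∈
  ...     | ∣S′∣≡k , adm = cong suc ∣S′∣≡k , admissible-inside⁺ col U free₀ adm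

  admissibleSubsets-unique : ∀ {M} (col : Fin M → Fin n) U k → Unique (admissibleSubsets col U k)
  admissibleSubsets-unique         col U zero    = [] ∷ []
  admissibleSubsets-unique {zero}  col U (suc k) = []
  admissibleSubsets-unique {suc M} col U (suc k) with U (head col)
  ... | true  = Uniqueₚ.++⁺ outsides [] λ ()
    where outsides = Uniqueₚ.map⁺ Vecₚ.∷-injectiveʳ (admissibleSubsets-unique (tail col) U (suc k))
  ... | false = Uniqueₚ.++⁺ outsides insides heads-differ
    where
    outsides = Uniqueₚ.map⁺ Vecₚ.∷-injectiveʳ (admissibleSubsets-unique (tail col) U (suc k))
    insides  = Uniqueₚ.map⁺ Vecₚ.∷-injectiveʳ (admissibleSubsets-unique (tail col) (occupy U (head col)) k)
    heads-differ : ∀ {S} → ¬ (S ∈ₗ map (outside ∷_) _ × S ∈ₗ map (inside ∷_) _)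
    heads-differ (S∈₁ , S∈₂) with ∈-map⁻ _ S∈₁ | ∈-map⁻ _ S∈₂
    ... | _ , _ , refl | _ , _ , ()

  length-admissibleSubsets : ∀ {M} (col : Fin M → Fin n) U k →
    length (admissibleSubsets col U k) ≡ esym (available col U) k
  length-admissibleSubsets         col U zero    = refl
  length-admissibleSubsets {zero}  col U (suc k) = sym (esym-zeros (available col U) nothing-available k)
    where
    nothing-available : ∀ j → available col U j ≡ 0
    nothing-available j with U j
    ... | true  = refl
    ... | false = refl
  length-admissibleSubsets {suc M} col U (suc k) with U (head col) in taken₀
  ... | true = begin
      length (map (outside ∷_) E ++ [])
    ≡⟨ cong length (Listₚ.++-identityʳ (map (outside ∷_) E)) ⟩
      length (map (outside ∷_) E)
    ≡⟨ Listₚ.length-map _ E ⟩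
      length E
    ≡⟨ length-admissibleSubsets (tail col) U (suc k) ⟩
      esym (available (tail col) U) (suc k)
    ≡⟨ esym-cong unaffected (suc k) ⟩
      esym (available col U) (suc k)
    ∎
    where
    open ≡-Reasoning
    E = admissibleSubsets (tail col) U (suc k)
    unaffected : available (tail col) U ≗ available col U
    unaffected j = if-else-cong (U j) λ free → sym (count-head-other col (c≢ free))
      where
      c≢ : ∀ {j} → U j ≡ false → head col ≢ j
      c≢ free c≡j with () ← trans (sym taken₀) (trans (cong U c≡j) free)
  ... | false = begin
      length (map (outside ∷_) E₁ ++ map (inside ∷_) E₂)
    ≡⟨ Listₚ.length-++ (map (outside ∷_) E₁) ⟩
      length (map (outside ∷_) E₁) + length (map (inside ∷_) E₂)
    ≡⟨ cong₂ _+_ (Listₚ.length-map _ E₁) (Listₚ.length-map _ E₂) ⟩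
      length E₁ + length E₂
    ≡⟨ cong₂ _+_ (length-admissibleSubsets (tail col) U (suc k))
                 (length-admissibleSubsets (tail col) (occupy U c) k) ⟩
      esym (available (tail col) U) (suc k) + esym (available (tail col) (occupy U c)) k
    ≡⟨ esym-increment (available (tail col) U) (available col U) (available (tail col) (occupy U c)) c
         raised unchanged cleared unchanged′ k ⟨
      esym (available col U) (suc k)
    ∎
    where
    open ≡-Reasoning
    c  = head col
    E₁ = admissibleSubsets (tail col) U (suc k)
    E₂ = admissibleSubsets (tail col) (occupy U c) k
    raised : available col U c ≡ suc (available (tail col) U c)
    raised = begin
        available col U c                  ≡⟨ cong (λ b → if b then 0 else count col c) taken₀ ⟩
        count col c                        ≡⟨ count-head col ⟩
        suc (count (tail col) c)           ≡⟨ cong (λ b → suc (if b then 0 else count (tail col) c)) taken₀ ⟨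
        suc (available (tail col) U c)     ∎
    unchanged : ∀ j → j ≢ c → available col U j ≡ available (tail col) U j
    unchanged j j≢c = if-else-cong (U j) λ _ → count-head-other col (≢-sym j≢c)
    cleared : available (tail col) (occupy U c) c ≡ 0
    cleared = cong (λ b → if b then 0 else count (tail col) c) (occupy-self U c)
    unchanged′ : ∀ j → j ≢ c → available (tail col) (occupy U c) j ≡ available (tail col) U j
    unchanged′ j j≢c = cong (λ b → if b then 0 else count (tail col) j) (occupy-other U j≢c)

  length-filter-tabulate : ∀ {X : Set} {M} (g : Fin M → X) (h : X → Fin n) j →
    length (filter (λ x → h x Fin.≟ j) (tabulate g)) ≡ count (h ∘ g) j
  length-filter-tabulate {M = zero}  g h j = refl
  length-filter-tabulate {M = suc M} g h j with h (g Fin.zero) Fin.≟ j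
  ... | yes _ = cong suc (length-filter-tabulate (tail g) h j)
  ... | no _  = length-filter-tabulate (tail g) h j

Unique⇒lookup-injective : ∀ {X : Set} (xs : List X) → Unique xs → Injective _≡_ _≡_ (List.lookup xs)
Unique⇒lookup-injective (x ∷ xs) (x∉ ∷ u) {Fin.zero}  {Fin.zero}  _  = refl
Unique⇒lookup-injective (x ∷ xs) (x∉ ∷ u) {Fin.zero}  {Fin.suc j} eq =
  ⊥-elim (All.lookup x∉ (∈-lookup j) eq)
Unique⇒lookup-injective (x ∷ xs) (x∉ ∷ u) {Fin.suc i} {Fin.zero}  eq =
  ⊥-elim (All.lookup x∉ (∈-lookup i) (sym eq))
Unique⇒lookup-injective (x ∷ xs) (x∉ ∷ u) {Fin.suc i} {Fin.suc j} eq =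
  cong Fin.suc (Unique⇒lookup-injective xs u eq)

same-image⇒same-size : ∀ {X : Set} {c N} (g : Fin c → X) (h : Fin N → X) →
  Injective _≡_ _≡_ g → Injective _≡_ _≡_ h →
  (∀ i → ∃ λ j → h j ≡ g i) → (∀ j → ∃ λ i → g i ≡ h j) → c ≡ N
same-image⇒same-size g h g-inj h-inj g⊆h h⊆g =
  ℕₚ.≤-antisym (Finₚ.injective⇒≤ g↪h) (Finₚ.injective⇒≤ h↪g)
  where
  g↪h : Injective _≡_ _≡_ (proj₁ ∘ g⊆h)
  g↪h {i} {i′} eq = g-inj (trans (sym (proj₂ (g⊆h i))) (trans (cong h eq) (proj₂ (g⊆h i′))))
  h↪g : Injective _≡_ _≡_ (proj₁ ∘ h⊆g)
  h↪g {j} {j′} eq = h-inj (trans (sym (proj₂ (h⊆g j))) (trans (cong g eq) (proj₂ (h⊆g j′))))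

incForestCount≡esym : ∀ {n} (G : Graph n) {k c} → IsIncForestCount G k c → c ≡ esym (cardE G) k
incForestCount≡esym G {k} {c} (g , g-inj , g-forests , g-onto) = begin
    c                         ≡⟨ same-image⇒same-size g (List.lookup E) g-inj E-inj g⊆E E⊆g ⟩
    length E                  ≡⟨ length-admissibleSubsets (upper G) (λ _ → false) k ⟩
    esym (count (upper G)) k  ≡⟨ esym-cong (λ j → length-filter-tabulate id (upper G) j) k ⟨
    esym (cardE G) k          ∎
  where
  open ≡-Reasoning
  E = admissibleSubsets (upper G) (λ _ → false) k
  E-inj : Injective _≡_ _≡_ (List.lookup E)
  E-inj = Unique⇒lookup-injective E (admissibleSubsets-unique (upper G) (λ _ → false) k)
  g⊆E : ∀ i → ∃ λ j → List.lookup E j ≡ g i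
  g⊆E i = Any.index gᵢ∈E , sym (lookup-index gᵢ∈E)
    where
    gᵢ∈E = admissibleSubsets-complete (upper G) (λ _ → false) k (g i) (proj₁ (g-forests i))
      (Equivalence.to (isIncForest⇔injectiveOn G (g i)) (proj₂ (g-forests i)) , λ _ → refl)
  E⊆g : ∀ j → ∃ λ i → g i ≡ List.lookup E j
  E⊆g j with admissibleSubsets-sound (upper G) (λ _ → false) k (List.lookup E j) (∈-lookup j)
  ... | size , injOn , _ = g-onto _ size (Equivalence.from (isIncForest⇔injectiveOn G _) injOn)

-- Vieta's formula for prodLin

prodLinCoeff : ∀ {n} → (Fin n → ℕ) → ℕ → ℤ
prodLinCoeff {n} v j = (-1ℤ ℤ.^ (n ∸ j)) ℤ.* + esym v (n ∸ j)

mulByT : (ℕ → ℤ) → ℕ → ℤ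
mulByT a zero    = + 0
mulByT a (suc j) = a j

addP-applyUpTo : ∀ k (a b c : ℕ → ℤ) → (∀ j → j < k → c j ≡ a j ℤ.+ b j) → c k ≡ a k →
  addP (applyUpTo a (suc k)) (applyUpTo b k) ≡ applyUpTo c (suc k)
addP-applyUpTo zero    a b c _   cₖ = cong [_] (sym cₖ)
addP-applyUpTo (suc k) a b c c≡a+b cₖ =
  cong₂ _∷_ (sym (c≡a+b 0 (s≤s z≤n)))
    (addP-applyUpTo k (a ∘ suc) (b ∘ suc) (c ∘ suc) (λ j j<k → c≡a+b (suc j) (s≤s j<k)) cₖ)

∸≡suc∸suc : ∀ n j → suc j ≤ n → n ∸ j ≡ suc (n ∸ suc j)
∸≡suc∸suc (suc n) zero    _         = refl
∸≡suc∸suc (suc n) (suc j) (s≤s j<n) = ∸≡suc∸suc n j j<n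

prodLinCoeff-top : ∀ {n} (v : Fin n → ℕ) → prodLinCoeff v n ≡ + 1
prodLinCoeff-top {n} v rewrite ℕₚ.n∸n≡0 n = refl

prodLinCoeff-suc : ∀ {n} (v : Fin (suc n) → ℕ) j → j < suc n →
  prodLinCoeff v j ≡ mulByT (prodLinCoeff (tail v)) j ℤ.+ ℤ.- (+ head v) ℤ.* prodLinCoeff (tail v) j
prodLinCoeff-suc {n} v zero _ = begin
    (-1ℤ ℤ.^ suc n) ℤ.* + (esym (tail v) (suc n) + head v * esym (tail v) n)
  ≡⟨ cong (λ x → (-1ℤ ℤ.^ suc n) ℤ.* + (x + head v * esym (tail v) n))
       (esym-beyond (tail v) (suc n) ℕₚ.≤-refl) ⟩
    (-1ℤ ℤ.^ suc n) ℤ.* + (head v * esym (tail v) n)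
  ≡⟨ cong ((-1ℤ ℤ.^ suc n) ℤ.*_) (ℤₚ.pos-* (head v) (esym (tail v) n)) ⟩
    (-1ℤ ℤ.^ suc n) ℤ.* (+ head v ℤ.* + esym (tail v) n)
  ≡⟨ solve 3 (λ s x e → (con -1ℤ :* s) :* (x :* e) := con (+ 0) :+ (:- x) :* (s :* e)) refl
       (-1ℤ ℤ.^ n) (+ head v) (+ esym (tail v) n) ⟩
    + 0 ℤ.+ ℤ.- (+ head v) ℤ.* prodLinCoeff (tail v) 0
  ∎
  where
  open ≡-Reasoning
  open ℤSolver.+-*-Solver
prodLinCoeff-suc {n} v (suc j) (s≤s j<n) = shifted (∸≡suc∸suc n j j<n)
  where
  open ℤSolver.+-*-Solver
  shifted : ∀ {d} → n ∸ j ≡ suc d →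
    (-1ℤ ℤ.^ (n ∸ j)) ℤ.* + esym v (n ∸ j) ≡
    (-1ℤ ℤ.^ (n ∸ j)) ℤ.* + esym (tail v) (n ∸ j) ℤ.+
    ℤ.- (+ head v) ℤ.* ((-1ℤ ℤ.^ d) ℤ.* + esym (tail v) d)
  shifted {d} eq rewrite eq =
    trans (cong ((-1ℤ ℤ.^ suc d) ℤ.*_)
            (trans (ℤₚ.pos-+ (esym (tail v) (suc d)) _)
                   (cong (λ x → + esym (tail v) (suc d) ℤ.+ x) (ℤₚ.pos-* (head v) _))))
      (solve 4 (λ s a x e → (con -1ℤ :* s) :* (a :+ x :* e) := (con -1ℤ :* s) :* a :+ (:- x) :* (s :* e))
        refl
        (-1ℤ ℤ.^ d) (+ esym (tail v) (suc d)) (+ head v) (+ esym (tail v) d))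

prodLin-coefficients : ∀ n (v : Fin n → ℕ) →
  prodLin n (λ j → + v j) ≡ applyUpTo (prodLinCoeff v) (suc n)
prodLin-coefficients zero    v = refl
prodLin-coefficients (suc n) v = begin
    mulLin (+ head v) (prodLin n (λ j → + tail v j))
  ≡⟨ cong (mulLin (+ head v)) (prodLin-coefficients n (tail v)) ⟩
    addP (+ 0 ∷ applyUpTo Q (suc n)) (map (ℤ.- (+ head v) ℤ.*_) (applyUpTo Q (suc n)))
  ≡⟨ cong (addP (+ 0 ∷ applyUpTo Q (suc n))) (Listₚ.map-applyUpTo Q _ (suc n)) ⟩
    addP (applyUpTo (mulByT Q) (suc (suc n))) (applyUpTo (λ j → ℤ.- (+ head v) ℤ.* Q j) (suc n))
  ≡⟨ addP-applyUpTo (suc n) (mulByT Q) (λ j → ℤ.- (+ head v) ℤ.* Q j) (prodLinCoeff v)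
       (prodLinCoeff-suc v) (trans (prodLinCoeff-top v) (sym (prodLinCoeff-top (tail v)))) ⟩
    applyUpTo (prodLinCoeff v) (suc (suc n))
  ∎
  where
  open ≡-Reasoning
  Q = prodLinCoeff (tail v)

prodLinCoeff-zero-root : ∀ {n} (v : Fin (suc n) → ℕ) → head v ≡ 0 → prodLinCoeff v 0 ≡ + 0
prodLinCoeff-zero-root {n} v v₀≡0 =
  trans (cong (λ x → (-1ℤ ℤ.^ suc n) ℤ.* + x)
          (trans (esym-head≡0 v v₀≡0 (suc n)) (esym-beyond (tail v) (suc n) ℕₚ.≤-refl)))
    (ℤₚ.*-zeroʳ (-1ℤ ℤ.^ suc n))

applyUpTo-cong : ∀ {A : Set} {a b : ℕ → A} → a ≗ b → ∀ k → applyUpTo a k ≡ applyUpTo b k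
applyUpTo-cong a≗b zero    = refl
applyUpTo-cong a≗b (suc k) = cong₂ _∷_ (a≗b 0) (applyUpTo-cong (a≗b ∘ suc) k)

cardE-zero≡0 : ∀ {n} (G : Graph (suc n)) → cardE G Fin.zero ≡ 0
cardE-zero≡0 G = cong length (Listₚ.filter-none (λ e → upper G e Fin.≟ Fin.zero) (tabulate⁺ upper≢0))
  where
  upper≢0 : ∀ e → upper G e ≢ Fin.zero
  upper≢0 e upper≡0 = ℕₚ.n≮0 (subst (proj₁ (edge G e) Fin.<_) upper≡0 (lt G e))

theorem6p3 : (n : ℕ) → 1 ≤ n → (G : Graph n) → (f : ℕ → ℕ) →
    (∀ k → IsIncForestCount G k (f k)) →
    IFcoeffs n f ≡ prodLin n (λ j → + cardE G j)
theorem6p3 (suc n) (s≤s _) G f counts = begin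
    IFcoeffs (suc n) f
  ≡⟨ cong (+ 0 ∷_) (Listₚ.map-applyUpTo suc _ (suc n)) ⟩
    + 0 ∷ applyUpTo (λ j → (-1ℤ ℤ.^ (n ∸ j)) ℤ.* + f (n ∸ j)) (suc n)
  ≡⟨ cong₂ _∷_ (sym (prodLinCoeff-zero-root (cardE G) (cardE-zero≡0 G)))
               (applyUpTo-cong fₖ≡eₖ (suc n)) ⟩
    applyUpTo (prodLinCoeff (cardE G)) (suc (suc n))
  ≡⟨ prodLin-coefficients (suc n) (cardE G) ⟨
    prodLin (suc n) (λ j → + cardE G j)
  ∎
  where
  open ≡-Reasoning
  fₖ≡eₖ : ∀ j → (-1ℤ ℤ.^ (n ∸ j)) ℤ.* + f (n ∸ j) ≡ prodLinCoeff (cardE G) (suc j)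
  fₖ≡eₖ j = cong (λ x → (-1ℤ ℤ.^ (n ∸ j)) ℤ.* + x) (incForestCount≡esym G (counts (n ∸ j)))
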